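{- Let $a$ be a nonincreasing graphic list of length $n$ with $\sum_{i=1}^n a_i=m$. Then $N_3(\alpha)\ge N_3(a)$, where $\alpha=(\alpha_1,\dots,\alpha_n)$ is given by $\alpha_i=\lfloor m/n\rfloor+1$ for $i\in\{1,\dots,m\bmod n\}$ and $\alpha_i=\lfloor m/n\rfloor$ for $i\in\{(m\bmod n)+1,\dots,n\}$.
   Context: For an integer list $a=(a_1,\dots,a_n)$, a graph realization is a simple graph (no loops, no multiple edges) on labeled vertices $v_1,\dots,v_n$ with $\deg(v_i)=a_i$; $a$ is graphic if one exists and $N_3(a)$ is the number of graph realizations ($0$ if none). -}

module Defs where

open import Data.Nat using (ℕ; zero; suc; _+_; _<_; _<?_; NonZero)
open import Data.Nat.DivMod using (_/_; _%_)
open import Data.Bool using (Bool; true; false; if_then_else_)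
open import Data.Fin using (Fin; toℕ)
open import Data.Fin.Properties using (all?)
open import Data.Vec using (Vec; []; _∷_; lookup; tabulate; count)
open import Data.List using (List; []; _∷_; map; concatMap; length; filter)
open import Data.Product using (_×_; Σ; _,_)
open import Relation.Nullary using (Dec; yes; no)
open import Relation.Nullary.Decidable using (_×-dec_; ⌊_⌋)
open import Relation.Binary.PropositionalEquality using (_≡_)
import Data.Bool.Properties as BoolP
import Data.Nat.Properties as NatP
open import Relation.Nullary.Decidable using (does)

-- A graph on labeled vertices v_1..v_n (= Fin n) is given by its adjacency
-- matrix: an n×n Boolean matrix.  M i j = true means v_i and v_j are adjacent.
AdjMatrix : ℕ → Set
AdjMatrix n = Vec (Vec Bool n) n

adj : ∀ {n} → AdjMatrix n → Fin n → Fin n → Bool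
adj M i j = lookup (lookup M i) j

deg : ∀ {n} → AdjMatrix n → Fin n → ℕ
deg M i = count (λ b → b Data.Bool.≟ true) (lookup M i)

IsSimple : ∀ {n} → AdjMatrix n → Set
IsSimple M = (∀ i j → adj M i j ≡ adj M j i) × (∀ i → adj M i i ≡ false)

IsRealization : ∀ {n} → Vec ℕ n → AdjMatrix n → Set
IsRealization a M = IsSimple M × (∀ i → deg M i ≡ lookup a i)

isRealization? : ∀ {n} (a : Vec ℕ n) (M : AdjMatrix n) → Dec (IsRealization a M)
isRealization? a M =
  ((all? λ i → all? λ j → adj M i j BoolP.≟ adj M j i)
    ×-dec (all? λ i → adj M i i BoolP.≟ false))
  ×-dec (all? λ i → deg M i NatP.≟ lookup a i)

allVecs : ∀ {A : Set} → List A → (k : ℕ) → List (Vec A k)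
allVecs xs zero = [] ∷ []
allVecs xs (suc k) = concatMap (λ x → map (x ∷_) (allVecs xs k)) xs

allMatrices : (n : ℕ) → List (AdjMatrix n)
allMatrices n = allVecs (allVecs (true ∷ false ∷ []) n) n

Graphic : ∀ {n} → Vec ℕ n → Set
Graphic {n} a = Σ (AdjMatrix n) (IsRealization a)

N₃ : ∀ {n} → Vec ℕ n → ℕ
N₃ {n} a = length (filter (isRealization? a) (allMatrices n))

Nonincreasing : ∀ {n} → Vec ℕ n → Set
Nonincreasing {n} a = ∀ (i j : Fin n) → toℕ i Data.Nat.≤ toℕ j → lookup a j Data.Nat.≤ lookup a i

-- α_i = ⌊m/n⌋+1 for i ∈ {1..m mod n}, ⌊m/n⌋ otherwise (0-based: toℕ i < m % n)
balanced : (n m : ℕ) → .{{_ : NonZero n}} → Vec ℕ n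
balanced n m = tabulate λ i → if does (toℕ i <? m % n) then suc (m / n) else m / n

-- Moving one unit from an entry a i = a j + 1 + L of a degree list to a smaller entry a j does
-- not decrease the number of realizations.  In a realization M, walk through the vertices
-- v ∉ {i, j} in order, counting +1 for a neighbour of i only and −1 for a neighbour of j only.
-- In total i has L + 1 more such neighbours than j, so the count reaches L; exchanging the
-- adjacencies to i and to j of every vertex from that point on moves exactly one neighbour from
-- i to j, and it leaves the walk up to that point untouched, so doing it twice gives M back.
-- Moving units from entries above the balanced list (whose entries are ⌊m/n⌋ or ⌊m/n⌋ + 1) to
-- entries below it therefore reaches the balanced list without decreasing N₃.
module Submission where

open import Defs
open import Data.Nat using (ℕ; _≤_; NonZero)
open import Data.Vec using (Vec)
open import Data.Nat.ListAction using (sum)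
open import Data.Vec using (toList)
open import Relation.Binary.PropositionalEquality using (_≡_)

open import Data.Nat using (zero; suc; pred; _+_; _*_; _∸_; _<_; _≤?_; _<?_; z≤n; s≤s; s≤s⁻¹; >-nonZero)
open import Data.Nat.Properties hiding (_≟_)
open import Data.Nat.DivMod using (_/_; _%_; m%n<n; m≡m%n+[m/n]*n)
open import Algebra.Properties.CommutativeMonoid.Sum +-0-commutativeMonoid
  using (sum-syntax; sum-cong-≗; ∑-distrib-+; sum-permute; sum-replicate-zero)
open import Data.Bool using (Bool; true; false; not; _∧_; if_then_else_)
import Data.Bool
open import Data.Empty using (⊥-elim)
open import Data.Fin using (Fin; zero; suc; toℕ)
open import Data.Fin.Properties using (_≟_; ¬∀⟶∃¬)
import Data.Fin.Permutation as Permutation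
open import Data.Fin.Permutation.Components using (transpose)
open import Data.List using (List; []; _∷_; _++_; length; map; filter; concatMap; cartesianProductWith)
open import Data.List.Properties using (length-map; length-removeAt′)
open import Data.List.Membership.Propositional using (_∈_; _─_)
open import Data.List.Membership.Propositional.Properties
  using (∈-map⁻; ∈-filter⁺; ∈-filter⁻; ∈-cartesianProductWith⁺)
open import Data.List.Relation.Binary.Subset.Propositional using (_⊆_)
open import Data.List.Relation.Unary.All as All using ([]; _∷_)
open import Data.List.Relation.Unary.Any using (here; there; index)
open import Data.List.Relation.Unary.Unique.Propositional using (Unique; []; _∷_)
import Data.List.Relation.Unary.Unique.Propositional.Properties as Unique
open import Data.Product using (_×_; _,_; proj₁; proj₂; ∃₂; swap)
open import Data.Vec using ([]; _∷_; lookup; tabulate; count; _[_]%=_)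
open import Data.Vec.Functional using (tail)
open import Data.Vec.Properties
  using (∷-injective; lookup∘updateAt; lookup∘updateAt′; lookup∘tabulate; tabulate∘lookup; tabulate-cong)
open import Function using (_∘_; id; const; Injective)
open import Function.Consequences.Propositional using (inverseʳ⇒injective; strictlyInverseʳ⇒inverseʳ)
open import Level using (0ℓ)
open import Relation.Binary.PropositionalEquality
  using (refl; sym; trans; cong; cong₂; subst; _≢_; _≗_; module ≡-Reasoning)
open import Relation.Nullary using (does; yes; no)
open import Relation.Nullary.Decidable using (dec-true; dec-false)
open import Relation.Unary using (Pred; Decidable)

bit : Bool → ℕ
bit true  = 1
bit false = 0

bit≤1 : ∀ s → bit s ≤ 1
bit≤1 true  = s≤s z≤n
bit≤1 false = z≤n

∑-+-cong : ∀ {n} {f g h l : Fin n → ℕ} → (∀ k → f k + g k ≡ h k + l k) →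
  ∑[ k < n ] f k + ∑[ k < n ] g k ≡ ∑[ k < n ] h k + ∑[ k < n ] l k
∑-+-cong {n} {f} {g} {h} {l} pointwise = begin
  ∑[ k < n ] f k + ∑[ k < n ] g k  ≡⟨ ∑-distrib-+ f g ⟨
  ∑[ k < n ] (f k + g k)           ≡⟨ sum-cong-≗ pointwise ⟩
  ∑[ k < n ] (h k + l k)           ≡⟨ ∑-distrib-+ h l ⟩
  ∑[ k < n ] h k + ∑[ k < n ] l k  ∎
  where open ≡-Reasoning

∑≡0⇒≗0 : ∀ {n} (f : Fin n → ℕ) → ∑[ k < n ] f k ≡ 0 → ∀ k → f k ≡ 0
∑≡0⇒≗0 f ∑f≡0 zero    = m+n≡0⇒m≡0 (f zero) ∑f≡0
∑≡0⇒≗0 f ∑f≡0 (suc k) = ∑≡0⇒≗0 (f ∘ suc) (m+n≡0⇒n≡0 (f zero) ∑f≡0) k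

∑-≤-≡⇒≗ : ∀ {n} {f g : Fin n → ℕ} → (∀ k → f k ≤ g k) →
  ∑[ k < n ] f k ≡ ∑[ k < n ] g k → ∀ k → f k ≡ g k
∑-≤-≡⇒≗ {n} {f} {g} f≤g ∑f≡∑g k =
  ≤-antisym (f≤g k) (m∸n≡0⇒m≤n (∑≡0⇒≗0 (λ k → g k ∸ f k) ∑[g∸f]≡0 k))
  where
  ∑[g∸f]≡0 : ∑[ k < n ] (g k ∸ f k) ≡ 0
  ∑[g∸f]≡0 = +-cancelʳ-≡ (∑[ k < n ] f k) _ 0 (begin
    ∑[ k < n ] (g k ∸ f k) + ∑[ k < n ] f k  ≡⟨ ∑-distrib-+ (λ k → g k ∸ f k) f ⟨
    ∑[ k < n ] (g k ∸ f k + f k)             ≡⟨ sum-cong-≗ (λ k → m∸n+n≡m (f≤g k)) ⟩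
    ∑[ k < n ] g k                           ≡⟨ ∑f≡∑g ⟨
    ∑[ k < n ] f k                           ∎)
    where open ≡-Reasoning

∑-const : ∀ n c → ∑[ k < n ] c ≡ n * c
∑-const zero    c = refl
∑-const (suc n) c = cong (c +_) (∑-const n c)

∑-bit-< : ∀ {n} r → r ≤ n → ∑[ k < n ] bit (does (toℕ k <? r)) ≡ r
∑-bit-< {zero}  zero    z≤n       = refl
∑-bit-< {suc n} zero    z≤n       = ∑-bit-< {n} zero z≤n
∑-bit-< {suc n} (suc r) (s≤s r≤n) = cong suc (∑-bit-< r r≤n)

δ : ∀ {n} → Fin n → Fin n → ℕ
δ i k = bit (does (k ≟ i))

δ-self : ∀ {n} (i : Fin n) → δ i i ≡ 1
δ-self i rewrite dec-true (i ≟ i) refl = refl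

δ-other : ∀ {n} {i k : Fin n} → k ≢ i → δ i k ≡ 0
δ-other {i = i} {k} k≢i rewrite dec-false (k ≟ i) k≢i = refl

∑-δ : ∀ {n} (i : Fin n) → ∑[ k < n ] δ i k ≡ 1
∑-δ {suc n} zero    = cong suc (sum-replicate-zero n)
∑-δ {suc n} (suc i) = ∑-δ i

∑-+-δ : ∀ {n} (f : Fin n → ℕ) (i : Fin n) → ∑[ k < n ] (f k + δ i k) ≡ suc (∑[ k < n ] f k)
∑-+-δ {n} f i =
  trans (∑-distrib-+ f (δ i)) (trans (cong (∑[ k < n ] f k +_) (∑-δ i)) (+-comm _ 1))

∑-transpose : ∀ {n} (i j : Fin n) (f : Fin n → ℕ) →
  ∑[ k < n ] f (transpose i j k) ≡ ∑[ k < n ] f k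
∑-transpose i j f = sym (sum-permute f (Permutation.transpose i j))

data Position {n} (i j : Fin n) : Fin n → Set where
  at-i      : Position i j i
  at-j      : j ≢ i → Position i j j
  elsewhere : ∀ {v} → v ≢ i → v ≢ j → Position i j v

position : ∀ {n} (i j v : Fin n) → Position i j v
position i j v with v ≟ i | v ≟ j
... | yes refl | _        = at-i
... | no v≢i   | yes refl = at-j v≢i
... | no v≢i   | no v≢j   = elsewhere v≢i v≢j

module _ {n} (i j : Fin n) where

  transpose-i : transpose i j i ≡ j
  transpose-i rewrite dec-true (i ≟ i) refl = refl

  transpose-j : transpose i j j ≡ i
  transpose-j with j ≟ i
  ... | yes refl = refl
  ... | no _ rewrite dec-true (j ≟ j) refl = refl

  transpose-other : ∀ {v} → v ≢ i → v ≢ j → transpose i j v ≡ v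
  transpose-other {v} v≢i v≢j rewrite dec-false (v ≟ i) v≢i | dec-false (v ≟ j) v≢j = refl

  transpose-involutive : ∀ v → transpose i j (transpose i j v) ≡ v
  transpose-involutive v with position i j v
  ... | at-i              = trans (cong (transpose i j) transpose-i) transpose-j
  ... | at-j _            = trans (cong (transpose i j) transpose-j) transpose-i
  ... | elsewhere v≢i v≢j =
    trans (cong (transpose i j) (transpose-other v≢i v≢j)) (transpose-other v≢i v≢j)

lookup-ext : ∀ {A : Set} {n} {xs ys : Vec A n} → (∀ k → lookup xs k ≡ lookup ys k) → xs ≡ ys
lookup-ext {xs = xs} {ys} xs≈ys =
  trans (sym (tabulate∘lookup xs)) (trans (tabulate-cong xs≈ys) (tabulate∘lookup ys))

sum-toList : ∀ {n} (a : Vec ℕ n) → sum (toList a) ≡ ∑[ k < n ] lookup a k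
sum-toList []      = refl
sum-toList (x ∷ a) = cong (x +_) (sum-toList a)

transfer : ∀ {n} → Fin n → Fin n → Vec ℕ n → Vec ℕ n
transfer i j a = a [ i ]%= pred [ j ]%= suc

excess : ∀ {n} → Vec ℕ n → Vec ℕ n → ℕ
excess {n} a b = ∑[ k < n ] (lookup a k ∸ lookup b k)

module _ {n} {i j : Fin n} (i≢j : i ≢ j) (a : Vec ℕ n) where

  lookup-transfer-i : lookup (transfer i j a) i ≡ pred (lookup a i)
  lookup-transfer-i = trans (lookup∘updateAt′ i j i≢j (a [ i ]%= pred)) (lookup∘updateAt i a)

  lookup-transfer-j : lookup (transfer i j a) j ≡ suc (lookup a j)
  lookup-transfer-j =
    trans (lookup∘updateAt j (a [ i ]%= pred)) (cong suc (lookup∘updateAt′ j i (i≢j ∘ sym) a))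

  lookup-transfer-other : ∀ {k} → k ≢ i → k ≢ j → lookup (transfer i j a) k ≡ lookup a k
  lookup-transfer-other {k} k≢i k≢j =
    trans (lookup∘updateAt′ k j k≢j (a [ i ]%= pred)) (lookup∘updateAt′ k i k≢i a)

  ∑-transfer : 0 < lookup a i → ∑[ k < n ] lookup (transfer i j a) k ≡ ∑[ k < n ] lookup a k
  ∑-transfer 0<a-i = suc-injective (begin
    suc (∑[ k < n ] lookup (transfer i j a) k)     ≡⟨ ∑-+-δ _ i ⟨
    ∑[ k < n ] (lookup (transfer i j a) k + δ i k) ≡⟨ sum-cong-≗ moved ⟩
    ∑[ k < n ] (lookup a k + δ j k)                ≡⟨ ∑-+-δ _ j ⟩
    suc (∑[ k < n ] lookup a k)                    ∎)
    where
    open ≡-Reasoning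
    moved : ∀ k → lookup (transfer i j a) k + δ i k ≡ lookup a k + δ j k
    moved k with position i j k
    ... | at-i rewrite lookup-transfer-i | δ-self i | δ-other i≢j =
      trans (+-comm _ 1) (trans (suc-pred (lookup a i) {{>-nonZero 0<a-i}}) (sym (+-identityʳ _)))
    ... | at-j j≢i rewrite lookup-transfer-j | δ-self j | δ-other j≢i =
      trans (cong suc (+-identityʳ _)) (+-comm 1 _)
    ... | elsewhere k≢i k≢j rewrite lookup-transfer-other k≢i k≢j | δ-other k≢i | δ-other k≢j = refl

  excess-transfer : ∀ b → lookup b i < lookup a i → lookup a j < lookup b j →
    suc (excess (transfer i j a) b) ≡ excess a b
  excess-transfer b b-i<a-i a-j<b-j = begin
    suc (excess (transfer i j a) b)                              ≡⟨ ∑-+-δ _ i ⟨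
    ∑[ k < n ] (lookup (transfer i j a) k ∸ lookup b k + δ i k)  ≡⟨ sum-cong-≗ moved ⟩
    excess a b                                                   ∎
    where
    open ≡-Reasoning
    pred-∸-+1 : ∀ {x y} → y < x → pred x ∸ y + 1 ≡ x ∸ y
    pred-∸-+1 {suc x} (s≤s y≤x) = trans (+-comm _ 1) (sym (+-∸-assoc 1 y≤x))
    moved : ∀ k → lookup (transfer i j a) k ∸ lookup b k + δ i k ≡ lookup a k ∸ lookup b k
    moved k with position i j k
    ... | at-i rewrite lookup-transfer-i | δ-self i = pred-∸-+1 b-i<a-i
    ... | at-j j≢i rewrite lookup-transfer-j | δ-other j≢i =
      trans (+-identityʳ _) (trans (m≤n⇒m∸n≡0 a-j<b-j) (sym (m≤n⇒m∸n≡0 (<⇒≤ a-j<b-j))))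
    ... | elsewhere k≢i k≢j rewrite lookup-transfer-other k≢i k≢j | δ-other k≢i = +-identityʳ _

module _ {n} (a b : Vec ℕ n) (∑a≡∑b : ∑[ k < n ] lookup a k ≡ ∑[ k < n ] lookup b k) where

  private
    excess-zero : (∀ k → lookup a k ≤ lookup b k) → excess a b ≡ 0
    excess-zero a≤b = trans (sum-cong-≗ (m≤n⇒m∸n≡0 ∘ a≤b)) (sum-replicate-zero n)

  excess≡0⇒≡ : excess a b ≡ 0 → a ≡ b
  excess≡0⇒≡ excess≡0 = lookup-ext (∑-≤-≡⇒≗ (λ k → m∸n≡0⇒m≤n (∑≡0⇒≗0 _ excess≡0 k)) ∑a≡∑b)

  surplus-deficit : ∀ {E} → excess a b ≡ suc E →
    ∃₂ λ i j → lookup b i < lookup a i × lookup a j < lookup b j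
  surplus-deficit excess≡1+E =
    let i , a-i≰b-i = ¬∀⟶∃¬ n _ (λ k → lookup a k ≤? lookup b k) (no-excess ∘ excess-zero)
        j , b-j≰a-j = ¬∀⟶∃¬ n _ (λ k → lookup b k ≤? lookup a k) (no-excess ∘ excess-zero ∘ reverse)
    in i , j , ≰⇒> a-i≰b-i , ≰⇒> b-j≰a-j
    where
    no-excess : excess a b ≢ 0
    no-excess excess≡0 = 0≢1+n (trans (sym excess≡0) excess≡1+E)
    reverse : (∀ k → lookup b k ≤ lookup a k) → ∀ k → lookup a k ≤ lookup b k
    reverse b≤a k = ≤-reflexive (sym (∑-≤-≡⇒≗ b≤a (sym ∑a≡∑b) k))

module _ {A : Set} where

  ∈-─ : ∀ {x y : A} {ys} → y ∈ ys → y ≢ x → (x∈ys : x ∈ ys) → y ∈ ys ─ x∈ys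
  ∈-─ (here y≡z) y≢x (here x≡z) = ⊥-elim (y≢x (trans y≡z (sym x≡z)))
  ∈-─ (there y∈) y≢x (here _)   = y∈
  ∈-─ (here y≡z) y≢x (there x∈) = here y≡z
  ∈-─ (there y∈) y≢x (there x∈) = there (∈-─ y∈ y≢x x∈)

  Unique-⊆⇒length≤ : ∀ {xs ys : List A} → Unique xs → xs ⊆ ys → length xs ≤ length ys
  Unique-⊆⇒length≤ []                                  _     = z≤n
  Unique-⊆⇒length≤ {x ∷ xs} {ys} (x∉xs ∷ unique) xs⊆ys =
    subst (suc (length xs) ≤_) (sym (length-removeAt′ ys (index x∈ys)))
      (s≤s (Unique-⊆⇒length≤ unique λ y∈xs →
        ∈-─ (xs⊆ys (there y∈xs)) (λ y≡x → All.lookup x∉xs y∈xs (sym y≡x)) x∈ys))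
    where
    x∈ys : x ∈ ys
    x∈ys = xs⊆ys (here refl)

  length-filter-≤ : ∀ {xs : List A} → Unique xs → (∀ x → x ∈ xs) →
    {P Q : Pred A 0ℓ} (P? : Decidable P) (Q? : Decidable Q) (f : A → A) → Injective _≡_ _≡_ f →
    (∀ {x} → P x → Q (f x)) → length (filter P? xs) ≤ length (filter Q? xs)
  length-filter-≤ {xs} unique complete P? Q? f f-injective P⇒Q∘f = begin
    length (filter P? xs)          ≡⟨ length-map f (filter P? xs) ⟨
    length (map f (filter P? xs))  ≤⟨ Unique-⊆⇒length≤ (Unique.map⁺ f-injective (Unique.filter⁺ P? unique)) image⊆ ⟩
    length (filter Q? xs)          ∎
    where
    open ≤-Reasoning
    image⊆ : map f (filter P? xs) ⊆ filter Q? xs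
    image⊆ y∈image with ∈-map⁻ f y∈image
    ... | x , x∈ , refl = ∈-filter⁺ Q? (complete (f x)) (P⇒Q∘f (proj₂ (∈-filter⁻ P? {xs = xs} x∈)))

  allVecs≡cartesianProduct : ∀ (xs : List A) k →
    allVecs xs (suc k) ≡ cartesianProductWith _∷_ xs (allVecs xs k)
  allVecs≡cartesianProduct xs k = go xs
    where
    go : ∀ ys → concatMap (λ y → map (y ∷_) (allVecs xs k)) ys ≡ cartesianProductWith _∷_ ys (allVecs xs k)
    go []       = refl
    go (y ∷ ys) = cong (map (y ∷_) (allVecs xs k) ++_) (go ys)

  ∈-allVecs : ∀ {xs : List A} → (∀ x → x ∈ xs) → ∀ {k} (v : Vec A k) → v ∈ allVecs xs k
  ∈-allVecs complete []      = here refl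
  ∈-allVecs {xs} complete {suc k} (x ∷ v) rewrite allVecs≡cartesianProduct xs k =
    ∈-cartesianProductWith⁺ _∷_ (complete x) (∈-allVecs complete v)

  allVecs-unique : ∀ {xs : List A} → Unique xs → ∀ k → Unique (allVecs xs k)
  allVecs-unique unique zero = [] ∷ []
  allVecs-unique {xs} unique (suc k) rewrite allVecs≡cartesianProduct xs k =
    Unique.cartesianProductWith⁺ _∷_ ∷-injective unique (allVecs-unique unique k)

∈-allMatrices : ∀ {n} (M : AdjMatrix n) → M ∈ allMatrices n
∈-allMatrices = ∈-allVecs (∈-allVecs λ { true → here refl ; false → there (here refl) })

allMatrices-unique : ∀ n → Unique (allMatrices n)
allMatrices-unique n = allVecs-unique (allVecs-unique (((λ ()) ∷ []) ∷ [] ∷ []) n) n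

N₃-≤-by-injection : ∀ {n} (a b : Vec ℕ n) (f : AdjMatrix n → AdjMatrix n) → Injective _≡_ _≡_ f →
  (∀ M → IsRealization a M → IsRealization b (f M)) → N₃ a ≤ N₃ b
N₃-≤-by-injection {n} a b f f-injective realizes =
  length-filter-≤ (allMatrices-unique n) ∈-allMatrices (isRealization? a) (isRealization? b)
    f f-injective (realizes _)

adj-tabulate : ∀ {n} (f : Fin n → Fin n → Bool) u v →
  adj (tabulate λ u → tabulate λ v → f u v) u v ≡ f u v
adj-tabulate f u v = trans (cong (λ row → lookup row v) (lookup∘tabulate _ u)) (lookup∘tabulate _ v)

adj-ext : ∀ {n} {M N : AdjMatrix n} → (∀ u v → adj M u v ≡ adj N u v) → M ≡ N
adj-ext M≈N = lookup-ext λ u → lookup-ext (M≈N u)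

count-true : ∀ {n} (xs : Vec Bool n) →
  count (λ b → b Data.Bool.≟ true) xs ≡ ∑[ v < n ] bit (lookup xs v)
count-true []           = refl
count-true (true  ∷ xs) = cong suc (count-true xs)
count-true (false ∷ xs) = count-true xs

deg≡∑ : ∀ {n} (M : AdjMatrix n) u → deg M u ≡ ∑[ v < n ] bit (adj M u v)
deg≡∑ M u = count-true (lookup M u)

-- The reflection walk

first-only : Bool × Bool → Bool
first-only (x , y) = x ∧ not y

second-only : Bool × Bool → Bool
second-only = first-only ∘ swap

-- The walk steps up on (true , false) and down on (false , true); reflected d p v holds once the
-- steps before v have climbed d.  next d x is the remaining climb after x when it was suc d before.
next : ℕ → Bool × Bool → ℕ
next d (true  , false) = d
next d (false , true)  = suc (suc d)
next d (true  , true)  = suc d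
next d (false , false) = suc d

reflected : ∀ {k} → ℕ → (Fin k → Bool × Bool) → Fin k → Bool
reflected zero    p v       = true
reflected (suc d) p zero    = false
reflected (suc d) p (suc v) = reflected (next d (p zero)) (tail p) v

reflect : ∀ {k} → ℕ → (Fin k → Bool × Bool) → Fin k → Bool × Bool
reflect d p v = if reflected d p v then swap (p v) else p v

reflected-cong : ∀ {k} d {p q : Fin k → Bool × Bool} → p ≗ q → reflected d p ≗ reflected d q
reflected-cong zero    p≗q v       = refl
reflected-cong (suc d) p≗q zero    = refl
reflected-cong (suc d) {q = q} p≗q (suc v) rewrite p≗q zero =
  reflected-cong (next d (q zero)) (p≗q ∘ suc) v

reflected-reflect : ∀ {k} d (p : Fin k → Bool × Bool) → reflected d (reflect d p) ≗ reflected d p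
reflected-reflect zero    p v       = refl
reflected-reflect (suc d) p zero    = refl
reflected-reflect (suc d) p (suc v) = reflected-reflect (next d (p zero)) (tail p) v

-- The walk moves by at most one per step, so a total climb beyond d passes through d exactly,
-- and the reflected part carries the remaining surplus of one.
reflected-surplus : ∀ {k} d (p : Fin k → Bool × Bool) →
  ∑[ v < k ] bit (first-only (p v)) ≡ suc (d + ∑[ v < k ] bit (second-only (p v))) →
  ∑[ v < k ] bit (reflected d p v ∧ first-only (p v)) ≡
    suc (∑[ v < k ] bit (reflected d p v ∧ second-only (p v)))
reflected-surplus zero    p surplus = surplus
reflected-surplus {zero}  (suc d) p ()
reflected-surplus {suc k} (suc d) p surplus =
  reflected-surplus (next d (p zero)) (tail p) (next-surplus (p zero) surplus)
  where
  F G : ℕ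
  F = ∑[ v < k ] bit (first-only (p (suc v)))
  G = ∑[ v < k ] bit (second-only (p (suc v)))
  next-surplus : ∀ x → bit (first-only x) + F ≡ suc (suc d + (bit (second-only x) + G)) →
    F ≡ suc (next d x + G)
  next-surplus (true  , false) eq = suc-injective eq
  next-surplus (false , true)  eq = trans eq (cong (2 +_) (+-suc d G))
  next-surplus (true  , true)  eq = eq
  next-surplus (false , false) eq = eq

bit-select : ∀ s x y → bit (if s then y else x) + bit (s ∧ first-only (x , y)) ≡
                       bit x + bit (s ∧ second-only (x , y))
bit-select false x     y     = refl
bit-select true  true  true  = refl
bit-select true  true  false = refl
bit-select true  false true  = refl
bit-select true  false false = refl

-- switch S M exchanges, for every vertex w with S w, the adjacencies of w to i and to j.
module Switching {n} (i j : Fin n) where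

  Avoids : (Fin n → Bool) → Set
  Avoids S = S i ≡ false × S j ≡ false

  twist : Bool → Fin n → Fin n
  twist s = if s then transpose i j else id

  switch : (Fin n → Bool) → AdjMatrix n → AdjMatrix n
  switch S M = tabulate λ u → tabulate λ v → adj M (twist (S v) u) (twist (S u) v)

  twist-involutive : ∀ s x → twist s (twist s x) ≡ x
  twist-involutive true  x = transpose-involutive i j x
  twist-involutive false x = refl

  twist-other : ∀ s {x} → x ≢ i → x ≢ j → twist s x ≡ x
  twist-other true  x≢i x≢j = transpose-other i j x≢i x≢j
  twist-other false x≢i x≢j = refl

  twist-invariant : ∀ {S} → Avoids S → ∀ s x → S (twist s x) ≡ S x
  twist-invariant {S} (Si , Sj) true x with position i j x
  ... | at-i              = trans (cong S (transpose-i i j)) (trans Sj (sym Si))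
  ... | at-j _            = trans (cong S (transpose-j i j)) (trans Si (sym Sj))
  ... | elsewhere x≢i x≢j = cong S (transpose-other i j x≢i x≢j)
  twist-invariant avoids false x = refl

  adj-switch : ∀ S M u v → adj (switch S M) u v ≡ adj M (twist (S v) u) (twist (S u) v)
  adj-switch S M = adj-tabulate λ u v → adj M (twist (S v) u) (twist (S u) v)

  switch-simple : ∀ S {M} → IsSimple M → IsSimple (switch S M)
  switch-simple S {M} (symmetric , loopless) =
    (λ u v → trans (adj-switch S M u v) (trans (symmetric _ _) (sym (adj-switch S M v u)))) ,
    (λ u → trans (adj-switch S M u u) (loopless _))

  switch-cong : ∀ {S S′} → S ≗ S′ → ∀ M → switch S M ≡ switch S′ M
  switch-cong {S} {S′} S≗S′ M = adj-ext λ u v →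
    trans (adj-switch S M u v)
      (trans (cong₂ (λ s t → adj M (twist s u) (twist t v)) (S≗S′ v) (S≗S′ u)) (sym (adj-switch S′ M u v)))

  switch-involutive : ∀ {S} → Avoids S → ∀ M → switch S (switch S M) ≡ M
  switch-involutive {S} avoids M = adj-ext λ u v → begin
    adj (switch S (switch S M)) u v
      ≡⟨ adj-switch S (switch S M) u v ⟩
    adj (switch S M) (twist (S v) u) (twist (S u) v)
      ≡⟨ adj-switch S M _ _ ⟩
    adj M (twist (S (twist (S u) v)) (twist (S v) u)) (twist (S (twist (S v) u)) (twist (S u) v))
      ≡⟨ cong₂ (adj M) (untwist u v) (untwist v u) ⟩
    adj M u v ∎
    where
    open ≡-Reasoning
    untwist : ∀ x y → twist (S (twist (S x) y)) (twist (S y) x) ≡ x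
    untwist x y = trans (cong (λ s → twist s (twist (S y) x)) (twist-invariant avoids (S x) y))
                        (twist-involutive (S y) x)

  ∑-select : ∀ (s x y : Fin n → Bool) →
    ∑[ v < n ] bit (if s v then y v else x v) + ∑[ v < n ] bit (s v ∧ first-only (x v , y v)) ≡
    ∑[ v < n ] bit (x v) + ∑[ v < n ] bit (s v ∧ second-only (x v , y v))
  ∑-select s x y = ∑-+-cong λ v → bit-select (s v) (x v) (y v)

  module _ (S : Fin n → Bool) (avoids : Avoids S) (M : AdjMatrix n) where

    row-i : ∀ v → adj (switch S M) i v ≡ (if S v then adj M j v else adj M i v)
    row-i v rewrite adj-switch S M i v | proj₁ avoids with S v
    ... | true  = cong (λ w → adj M w v) (transpose-i i j)
    ... | false = refl

    row-j : ∀ v → adj (switch S M) j v ≡ (if S v then adj M i v else adj M j v)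
    row-j v rewrite adj-switch S M j v | proj₂ avoids with S v
    ... | true  = cong (λ w → adj M w v) (transpose-j i j)
    ... | false = refl

    deg-switch-i : deg (switch S M) i + ∑[ v < n ] bit (S v ∧ first-only (adj M i v , adj M j v)) ≡
                   deg M i + ∑[ v < n ] bit (S v ∧ second-only (adj M i v , adj M j v))
    deg-switch-i rewrite deg≡∑ (switch S M) i | deg≡∑ M i | sum-cong-≗ (cong bit ∘ row-i) =
      ∑-select S (adj M i) (adj M j)

    deg-switch-j : deg (switch S M) j + ∑[ v < n ] bit (S v ∧ second-only (adj M i v , adj M j v)) ≡
                   deg M j + ∑[ v < n ] bit (S v ∧ first-only (adj M i v , adj M j v))
    deg-switch-j rewrite deg≡∑ (switch S M) j | deg≡∑ M j | sum-cong-≗ (cong bit ∘ row-j) =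
      ∑-select S (adj M j) (adj M i)

    deg-switch-other : ∀ {u} → u ≢ i → u ≢ j → deg (switch S M) u ≡ deg M u
    deg-switch-other {u} u≢i u≢j = begin
      deg (switch S M) u                        ≡⟨ deg≡∑ (switch S M) u ⟩
      ∑[ v < n ] bit (adj (switch S M) u v)     ≡⟨ sum-cong-≗ (cong bit ∘ row-u) ⟩
      ∑[ v < n ] bit (adj M u (twist (S u) v))  ≡⟨ twisted-row (S u) ⟩
      ∑[ v < n ] bit (adj M u v)                ≡⟨ deg≡∑ M u ⟨
      deg M u                                   ∎
      where
      open ≡-Reasoning
      row-u : ∀ v → adj (switch S M) u v ≡ adj M u (twist (S u) v)
      row-u v = trans (adj-switch S M u v) (cong (λ w → adj M w (twist (S u) v)) (twist-other (S v) u≢i u≢j))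
      twisted-row : ∀ s → ∑[ v < n ] bit (adj M u (twist s v)) ≡ ∑[ v < n ] bit (adj M u v)
      twisted-row true  = ∑-transpose i j (bit ∘ adj M u)
      twisted-row false = refl

bit-exchange : ∀ x y → bit x + bit (second-only (x , y)) ≡ bit y + bit (first-only (x , y))
bit-exchange true  true  = refl
bit-exchange true  false = refl
bit-exchange false true  = refl
bit-exchange false false = refl

masked-first-only : ∀ e r x y → (e ∧ r) ∧ first-only (x , y) ≡ r ∧ first-only (e ∧ x , e ∧ y)
masked-first-only true  r     x y = refl
masked-first-only false true  x y = refl
masked-first-only false false x y = refl

masked-select : ∀ e r x y →
  (e ∧ (if e ∧ r then y else x) , e ∧ (if e ∧ r then x else y)) ≡
  (if r then swap (e ∧ x , e ∧ y) else (e ∧ x , e ∧ y))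
masked-select true  true  x y = refl
masked-select true  false x y = refl
masked-select false true  x y = refl
masked-select false false x y = refl

+-suc-cancel : ∀ x y g → x + suc g ≡ y + g → suc x ≡ y
+-suc-cancel x y g eq = +-cancelʳ-≡ g (suc x) y (trans (sym (+-suc x g)) eq)

-- The profile hides i and j as (false , false), so the walk only sees the other vertices.
module Transfer {n} (i j : Fin n) (L : ℕ) where
  open Switching i j

  outside : Fin n → Bool
  outside v = not (does (v ≟ i)) ∧ not (does (v ≟ j))

  outside-i : outside i ≡ false
  outside-i rewrite dec-true (i ≟ i) refl = refl

  outside-j : outside j ≡ false
  outside-j rewrite dec-true (j ≟ j) refl with does (j ≟ i)
  ... | true  = refl
  ... | false = refl

  outside-other : ∀ {v} → v ≢ i → v ≢ j → outside v ≡ true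
  outside-other {v} v≢i v≢j rewrite dec-false (v ≟ i) v≢i | dec-false (v ≟ j) v≢j = refl

  rows profile : AdjMatrix n → Fin n → Bool × Bool
  rows    M v = (adj M i v , adj M j v)
  profile M v = (outside v ∧ adj M i v , outside v ∧ adj M j v)

  selected : AdjMatrix n → Fin n → Bool
  selected M v = outside v ∧ reflected L (profile M) v

  selected-avoids : ∀ M → Avoids (selected M)
  selected-avoids M rewrite outside-i | outside-j = refl , refl

  T : AdjMatrix n → AdjMatrix n
  T M = switch (selected M) M

  profile-T : ∀ M → profile (T M) ≗ reflect L (profile M)
  profile-T M v =
    trans (cong₂ (λ x y → (outside v ∧ x , outside v ∧ y))
                 (row-i (selected M) (selected-avoids M) M v) (row-j (selected M) (selected-avoids M) M v))
          (masked-select (outside v) (reflected L (profile M) v) (adj M i v) (adj M j v))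

  selected-T : ∀ M → selected (T M) ≗ selected M
  selected-T M v = cong (outside v ∧_)
    (trans (reflected-cong L (profile-T M) v) (reflected-reflect L (profile M) v))

  T-involutive : ∀ M → T (T M) ≡ M
  T-involutive M =
    trans (switch-cong (selected-T M) (T M)) (switch-involutive {selected M} (selected-avoids M) M)

  T-injective : Injective _≡_ _≡_ T
  T-injective = inverseʳ⇒injective {f⁻¹ = T} T (strictlyInverseʳ⇒inverseʳ T T-involutive)

  private
    #first #second : (Fin n → Bool × Bool) → ℕ
    #first  p = ∑[ v < n ] bit (first-only (p v))
    #second p = ∑[ v < n ] bit (second-only (p v))

    #first-in #second-in : (Fin n → Bool) → (Fin n → Bool × Bool) → ℕ
    #first-in  s p = ∑[ v < n ] bit (s v ∧ first-only (p v))
    #second-in s p = ∑[ v < n ] bit (s v ∧ second-only (p v))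

  deg-profile : ∀ M → IsSimple M → deg M i + #second (profile M) ≡ deg M j + #first (profile M)
  deg-profile M (symmetric , loopless) = begin
    deg M i + #second (profile M)
      ≡⟨ cong (_+ #second (profile M)) (deg≡∑ M i) ⟩
    ∑[ v < n ] bit (adj M i v) + #second (profile M)
      ≡⟨ ∑-+-cong exchange ⟩
    ∑[ v < n ] bit (adj M j (transpose i j v)) + #first (profile M)
      ≡⟨ cong (_+ #first (profile M)) (trans (∑-transpose i j (bit ∘ adj M j)) (sym (deg≡∑ M j))) ⟩
    deg M j + #first (profile M) ∎
    where
    open ≡-Reasoning
    exchange : ∀ v → bit (adj M i v) + bit (second-only (profile M v)) ≡
                     bit (adj M j (transpose i j v)) + bit (first-only (profile M v))
    exchange v with position i j v
    ... | at-i rewrite outside-i | transpose-i i j | loopless i | loopless j = refl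
    ... | at-j _ rewrite outside-j | transpose-j i j | symmetric i j = refl
    ... | elsewhere v≢i v≢j rewrite outside-other v≢i v≢j | transpose-other i j v≢i v≢j =
      bit-exchange (adj M i v) (adj M j v)

  profile-surplus : ∀ M → IsSimple M → deg M i ≡ suc (deg M j + L) →
    #first (profile M) ≡ suc (L + #second (profile M))
  profile-surplus M simple deg-i≡ = +-cancelˡ-≡ (deg M j) _ _ (begin
    deg M j + #first (profile M)              ≡⟨ deg-profile M simple ⟨
    deg M i + #second (profile M)             ≡⟨ cong (_+ #second (profile M)) deg-i≡ ⟩
    suc (deg M j + L) + #second (profile M)   ≡⟨ cong suc (+-assoc (deg M j) L _) ⟩
    suc (deg M j + (L + #second (profile M))) ≡⟨ +-suc (deg M j) _ ⟨
    deg M j + suc (L + #second (profile M))   ∎)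
    where open ≡-Reasoning

  selected-surplus : ∀ M → IsSimple M → deg M i ≡ suc (deg M j + L) →
    #first-in (selected M) (rows M) ≡ suc (#second-in (selected M) (rows M))
  selected-surplus M simple deg-i≡ = begin
    #first-in (selected M) (rows M)
      ≡⟨ sum-cong-≗ (λ v → cong bit (masked-first-only (outside v) _ (adj M i v) (adj M j v))) ⟩
    #first-in (reflected L (profile M)) (profile M)
      ≡⟨ reflected-surplus L (profile M) (profile-surplus M simple deg-i≡) ⟩
    suc (#second-in (reflected L (profile M)) (profile M))
      ≡⟨ cong suc (sum-cong-≗ (λ v → cong bit (masked-first-only (outside v) _ (adj M j v) (adj M i v)))) ⟨
    suc (#second-in (selected M) (rows M)) ∎
    where open ≡-Reasoning

  T-realizes : ∀ {a} → lookup a i ≡ suc (lookup a j + L) →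
    ∀ M → IsRealization a M → IsRealization (transfer i j a) (T M)
  T-realizes {a} a-i≡ M (simple , degM) = switch-simple (selected M) {M} simple , deg-T
    where
    open ≡-Reasoning
    i≢j : i ≢ j
    i≢j refl = m≢1+m+n (lookup a i) a-i≡
    surplus : #first-in (selected M) (rows M) ≡ suc (#second-in (selected M) (rows M))
    surplus = selected-surplus M simple (trans (degM i) (trans a-i≡ (cong (λ d → suc (d + L)) (sym (degM j)))))
    avoids : Avoids (selected M)
    avoids = selected-avoids M

    deg-T : ∀ u → deg (T M) u ≡ lookup (transfer i j a) u
    deg-T u with position i j u
    ... | at-i = begin
      deg (T M) i        ≡⟨ cong pred (+-suc-cancel _ _ _
                              (trans (cong (deg (T M) i +_) (sym surplus)) (deg-switch-i (selected M) avoids M))) ⟩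
      pred (deg M i)     ≡⟨ cong pred (degM i) ⟩
      pred (lookup a i)  ≡⟨ lookup-transfer-i i≢j a ⟨
      lookup (transfer i j a) i ∎
    ... | at-j _ = begin
      deg (T M) j        ≡⟨ +-suc-cancel _ _ _
                              (sym (trans (deg-switch-j (selected M) avoids M) (cong (deg M j +_) surplus))) ⟨
      suc (deg M j)      ≡⟨ cong suc (degM j) ⟩
      suc (lookup a j)   ≡⟨ lookup-transfer-j i≢j a ⟨
      lookup (transfer i j a) j ∎
    ... | elsewhere u≢i u≢j = begin
      deg (T M) u        ≡⟨ deg-switch-other (selected M) avoids M u≢i u≢j ⟩
      deg M u            ≡⟨ degM u ⟩
      lookup a u         ≡⟨ lookup-transfer-other i≢j a u≢i u≢j ⟨
      lookup (transfer i j a) u ∎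

N₃-≤-transfer : ∀ {n} (i j : Fin n) (a : Vec ℕ n) → lookup a j < lookup a i → N₃ a ≤ N₃ (transfer i j a)
N₃-≤-transfer i j a a-j<a-i =
  N₃-≤-by-injection a (transfer i j a) T T-injective (T-realizes {a} (sym (m+[n∸m]≡n a-j<a-i)))
  where open Transfer i j (lookup a i ∸ suc (lookup a j))

-- Balancing

N₃-≤-near-constant : ∀ {n} (b : Vec ℕ n) (q : ℕ) → (∀ k → q ≤ lookup b k) → (∀ k → lookup b k ≤ suc q) →
  ∀ a → ∑[ k < n ] lookup a k ≡ ∑[ k < n ] lookup b k → N₃ a ≤ N₃ b
N₃-≤-near-constant {n} b q q≤b b≤1+q a ∑a≡∑b = go _ a refl ∑a≡∑b
  where
  go : ∀ E a → excess a b ≡ E → ∑[ k < n ] lookup a k ≡ ∑[ k < n ] lookup b k → N₃ a ≤ N₃ b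
  go zero    a excess≡0 ∑a≡∑b = ≤-reflexive (cong N₃ (excess≡0⇒≡ a b ∑a≡∑b excess≡0))
  go (suc E) a excess≡1+E ∑a≡∑b with surplus-deficit a b ∑a≡∑b excess≡1+E
  ... | i , j , b-i<a-i , a-j<b-j =
    ≤-trans (N₃-≤-transfer i j a a-j<a-i)
            (go E (transfer i j a) (suc-injective (trans (excess-transfer i≢j a b b-i<a-i a-j<b-j) excess≡1+E))
                  (trans (∑-transfer i≢j a (≤-<-trans z≤n b-i<a-i)) ∑a≡∑b))
    where
    i≢j : i ≢ j
    i≢j refl = <-asym b-i<a-i a-j<b-j
    -- a j < b j ≤ q + 1 ≤ b i + 1 ≤ a i
    a-j<a-i : lookup a j < lookup a i
    a-j<a-i = ≤-<-trans (≤-trans (s≤s⁻¹ (≤-trans a-j<b-j (b≤1+q j))) (q≤b i)) b-i<a-i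

module _ (n m : ℕ) .{{_ : NonZero n}} where

  lookup-balanced : ∀ k → lookup (balanced n m) k ≡ m / n + bit (does (toℕ k <? m % n))
  lookup-balanced k rewrite lookup∘tabulate (λ k → if does (toℕ k <? m % n) then suc (m / n) else m / n) k
    with does (toℕ k <? m % n)
  ... | true  = +-comm 1 (m / n)
  ... | false = sym (+-identityʳ (m / n))

  balanced-≥ : ∀ k → m / n ≤ lookup (balanced n m) k
  balanced-≥ k rewrite lookup-balanced k = m≤m+n (m / n) _

  balanced-≤ : ∀ k → lookup (balanced n m) k ≤ suc (m / n)
  balanced-≤ k rewrite lookup-balanced k =
    ≤-trans (+-monoʳ-≤ (m / n) (bit≤1 _)) (≤-reflexive (+-comm (m / n) 1))

  ∑-balanced : ∑[ k < n ] lookup (balanced n m) k ≡ m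
  ∑-balanced = begin
    ∑[ k < n ] lookup (balanced n m) k                           ≡⟨ sum-cong-≗ lookup-balanced ⟩
    ∑[ k < n ] (m / n + bit (does (toℕ k <? m % n)))             ≡⟨ ∑-distrib-+ {n} (const (m / n)) _ ⟩
    ∑[ k < n ] (m / n) + ∑[ k < n ] bit (does (toℕ k <? m % n))
      ≡⟨ cong₂ _+_ (∑-const n (m / n)) (∑-bit-< (m % n) (<⇒≤ (m%n<n m n))) ⟩
    n * (m / n) + m % n                                          ≡⟨ cong (_+ m % n) (*-comm n (m / n)) ⟩
    m / n * n + m % n                                            ≡⟨ +-comm (m / n * n) (m % n) ⟩
    m % n + m / n * n                                            ≡⟨ m≡m%n+[m/n]*n m n ⟨
    m                                                            ∎
    where open ≡-Reasoning

corollary8 : (n : ℕ) → .{{_ : NonZero n}} → (a : Vec ℕ n) → Nonincreasing a → Graphic a →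
    (m : ℕ) → sum (toList a) ≡ m → N₃ a ≤ N₃ (balanced n m)
corollary8 n a _ _ m ∑a≡m =
  N₃-≤-near-constant (balanced n m) (m / n) (balanced-≥ n m) (balanced-≤ n m) a (begin
    ∑[ k < n ] lookup a k                ≡⟨ sum-toList a ⟨
    sum (toList a)                       ≡⟨ ∑a≡m ⟩
    m                                    ≡⟨ ∑-balanced n m ⟨
    ∑[ k < n ] lookup (balanced n m) k   ∎)
  where open ≡-Reasoning
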